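{- Let $\mathsf{G}=\prod_{v\in\lozenge^+}\mathsf{G}_N(F^+_v)$ and $\mathsf{B}=\prod_{v\in\lozenge^+}\mathsf{B}_N(F^+_v)\subseteq\mathsf{G}$ be as in the context. For every subgroup $\mathrm{k}'$ of $\mathsf{G}$ put $\mathrm{k}'_{\mathsf{B}}\coloneqq\mathrm{k}'\cap\mathsf{B}$, and for subgroups $\mathrm{k},\mathrm{k}'$ of $\mathsf{G}$ write $\mathrm{k}\to\mathrm{k}'$ if both \[ \mathrm{k}_{\mathsf{B}}\subseteq\mathrm{k}'_{\mathsf{B}}\qquad\text{and}\qquad \mathrm{k}'\subseteq\mathrm{k}\cdot\mathrm{k}'_{\mathsf{B}} \] hold. For an open compact subgroup $\mathrm{k}$ of $\mathsf{G}$, put \[ \mathfrak{B}_{\mathrm{k}}\coloneqq\{b\in\mathsf{B}\mid \mathrm{k}\to b\mathrm{k}b^{ -1}\}. \] Then $\mathfrak{B}_{\mathrm{k}}$ is a submonoid of $\mathsf{B}$, i.e.\ it contains the identity and $bb'\in\mathfrak{B}_{\mathrm{k}}$ for all $b,b'\in\mathfrak{B}_{\mathrm{k}}$.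
   Context: $F$ is a CM number field with maximal totally real subfield $F^+$, $p$ is a rational prime unramified in $F$, and $\lozenge^+$ is a finite set of places of $F^+$ above $p$; $F^+_v$ denotes the completion at $v$. $\mathrm{V}_N$ is a hermitian space of rank $N\geq1$ over $F$ (with respect to $F/F^+$), split at every place of $\lozenge^+$, and $\mathsf{G}_N=\mathrm{U}(\mathrm{V}_N)$ is its unitary group, a reductive group over $F^+$. $\mathsf{B}_N$ is a Borel subgroup of $\mathsf{G}_N\otimes_{F^+}F^+_{\lozenge^+}$, where $F^+_{\lozenge^+}=\prod_{v\in\lozenge^+}F^+_v$; these groups of points carry their natural locally profinite topologies. -}

module Defs where

open import Level using (Level; _⊔_)
open import Algebra.Bundles using (Group)
open import Data.Product using (Σ; ∃; ∃₂; _×_; _,_)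
open import Relation.Unary using (Pred; _∈_; _⊆_; _∩_)

module _ {c ℓ : Level} (G : Group c ℓ) where
  open Group G

  record IsSubgroup {p : Level} (H : Pred Carrier p) : Set (c ⊔ ℓ ⊔ p) where
    field
      resp : ∀ {x y} → x ≈ y → H x → H y
      ε∈   : ε ∈ H
      ∙∈   : ∀ {x y} → H x → H y → H (x ∙ y)
      ⁻¹∈  : ∀ {x} → H x → H (x ⁻¹)

  _·_ : ∀ {p} → Pred Carrier p → Pred Carrier p → Pred Carrier (c ⊔ ℓ ⊔ p)
  (H · K) g = ∃₂ λ x y → H x × K y × g ≈ x ∙ y

  -- conjugate subgroup  b H b⁻¹ = { g | b⁻¹ g b ∈ H }
  conj : ∀ {p} → Carrier → Pred Carrier p → Pred Carrier p
  conj b H g = H ((b ⁻¹ ∙ g) ∙ b)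

  Arrow : ∀ {p} → Pred Carrier p → Pred Carrier p → Pred Carrier p → Set (c ⊔ ℓ ⊔ p)
  Arrow B k k' = ((k ∩ B) ⊆ (k' ∩ B)) × (k' ⊆ (k · (k' ∩ B)))

  𝔅 : ∀ {p} → Pred Carrier p → Pred Carrier p → Pred Carrier (c ⊔ ℓ ⊔ p)
  𝔅 B k b = B b × Arrow B k (conj b k)

-- Conjugation by b ∈ B is an automorphism of G preserving B, so it transports the relation
-- k → k' to b k b⁻¹ → b k' b⁻¹; and → is transitive onto subgroups. For b, b' ∈ 𝔅_k this
-- gives the chain  k → b k b⁻¹ → b (b' k b'⁻¹) b⁻¹ = (b b') k (b b')⁻¹,  while k → k is
-- immediate, so 𝔅_k is closed under products and contains 1.
module Submission where

open import Defs
open import Level using (Level)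
open import Algebra.Bundles using (Group)
open import Data.Product using (_×_; _,_; proj₁)
open import Relation.Unary using (Pred; _∈_; _≐_)
open import Relation.Unary.Properties using (≐-sym)
import Algebra.Properties.Group as GroupProperties
import Relation.Binary.Reasoning.Setoid as SetoidReasoning

module _ {c ℓ : Level} (G : Group c ℓ) where
  open Group G
  open GroupProperties G using (ε⁻¹≈ε; ⁻¹-anti-homo-∙; inverseʳ-unique)
  open SetoidReasoning setoid

  infixl 7.5 _^_

  -- Right conjugation action, so that conj b H = { g | g ^ b ∈ H }.
  _^_ : Carrier → Carrier → Carrier
  x ^ b = (b ⁻¹ ∙ x) ∙ b

  ^-congˡ : ∀ {x y} b → x ≈ y → x ^ b ≈ y ^ b
  ^-congˡ b x≈y = ∙-congʳ (∙-congˡ x≈y)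

  ^-congʳ : ∀ x {b b'} → b ≈ b' → x ^ b ≈ x ^ b'
  ^-congʳ x b≈b' = ∙-cong (∙-congʳ (⁻¹-cong b≈b')) b≈b'

  ^-identityʳ : ∀ x → x ^ ε ≈ x
  ^-identityʳ x = begin
    (ε ⁻¹ ∙ x) ∙ ε ≈⟨ identityʳ _ ⟩
    ε ⁻¹ ∙ x       ≈⟨ ∙-congʳ ε⁻¹≈ε ⟩
    ε ∙ x          ≈⟨ identityˡ x ⟩
    x              ∎

  ^-∙-assoc : ∀ x b b' → x ^ b ^ b' ≈ x ^ (b ∙ b')
  ^-∙-assoc x b b' = begin
    (b' ⁻¹ ∙ ((b ⁻¹ ∙ x) ∙ b)) ∙ b' ≈⟨ ∙-congʳ (assoc _ _ _) ⟨
    ((b' ⁻¹ ∙ (b ⁻¹ ∙ x)) ∙ b) ∙ b' ≈⟨ assoc _ _ _ ⟩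
    (b' ⁻¹ ∙ (b ⁻¹ ∙ x)) ∙ (b ∙ b') ≈⟨ ∙-congʳ (assoc _ _ _) ⟨
    ((b' ⁻¹ ∙ b ⁻¹) ∙ x) ∙ (b ∙ b') ≈⟨ ∙-congʳ (∙-congʳ (⁻¹-anti-homo-∙ b b')) ⟨
    ((b ∙ b') ⁻¹ ∙ x) ∙ (b ∙ b')    ∎

  ^-distribʳ-∙ : ∀ x y b → (x ∙ y) ^ b ≈ x ^ b ∙ y ^ b
  ^-distribʳ-∙ x y b = begin
    (b ⁻¹ ∙ (x ∙ y)) ∙ b                ≈⟨ ∙-congʳ (assoc _ _ _) ⟨
    ((b ⁻¹ ∙ x) ∙ y) ∙ b                ≈⟨ assoc _ _ _ ⟩
    (b ⁻¹ ∙ x) ∙ (y ∙ b)                ≈⟨ ∙-congˡ (∙-congʳ (identityˡ y)) ⟨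
    (b ⁻¹ ∙ x) ∙ ((ε ∙ y) ∙ b)          ≈⟨ ∙-congˡ (∙-congʳ (∙-congʳ (inverseʳ b))) ⟨
    (b ⁻¹ ∙ x) ∙ (((b ∙ b ⁻¹) ∙ y) ∙ b) ≈⟨ ∙-congˡ (∙-congʳ (assoc _ _ _)) ⟩
    (b ⁻¹ ∙ x) ∙ ((b ∙ (b ⁻¹ ∙ y)) ∙ b) ≈⟨ ∙-congˡ (assoc _ _ _) ⟩
    (b ⁻¹ ∙ x) ∙ (b ∙ ((b ⁻¹ ∙ y) ∙ b)) ≈⟨ assoc _ _ _ ⟨
    ((b ⁻¹ ∙ x) ∙ b) ∙ ((b ⁻¹ ∙ y) ∙ b) ∎

  ^-^-inverse : ∀ x {b b'} → b ∙ b' ≈ ε → x ^ b ^ b' ≈ x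
  ^-^-inverse x {b} {b'} bb'≈ε = begin
    x ^ b ^ b'   ≈⟨ ^-∙-assoc x b b' ⟩
    x ^ (b ∙ b') ≈⟨ ^-congʳ x bb'≈ε ⟩
    x ^ ε        ≈⟨ ^-identityʳ x ⟩
    x            ∎

  ε-^ : ∀ b → ε ^ b ≈ ε
  ε-^ b = begin
    (b ⁻¹ ∙ ε) ∙ b ≈⟨ ∙-congʳ (identityʳ _) ⟩
    b ⁻¹ ∙ b       ≈⟨ inverseˡ b ⟩
    ε              ∎

  ⁻¹-^ : ∀ x b → x ⁻¹ ^ b ≈ (x ^ b) ⁻¹
  ⁻¹-^ x b = inverseʳ-unique (x ^ b) (x ⁻¹ ^ b) (begin
    x ^ b ∙ x ⁻¹ ^ b ≈⟨ ^-distribʳ-∙ x (x ⁻¹) b ⟨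
    (x ∙ x ⁻¹) ^ b   ≈⟨ ^-congˡ b (inverseʳ x) ⟩
    ε ^ b            ≈⟨ ε-^ b ⟩
    ε                ∎)

  module _ {p : Level} {H : Pred Carrier p} (H-sub : IsSubgroup G H) where
    open IsSubgroup H-sub

    ^-closed : ∀ {x b} → x ∈ H → b ∈ H → x ^ b ∈ H
    ^-closed x∈H b∈H = ∙∈ (∙∈ (⁻¹∈ b∈H) x∈H) b∈H

    conj-isSubgroup : ∀ b → IsSubgroup G (conj G b H)
    conj-isSubgroup b = record
      { resp = λ x≈y → resp (^-congˡ b x≈y)
      ; ε∈   = resp (sym (ε-^ b)) ε∈
      ; ∙∈   = λ {x} {y} x^b∈H y^b∈H → resp (sym (^-distribʳ-∙ x y b)) (∙∈ x^b∈H y^b∈H)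
      ; ⁻¹∈  = λ {x} x^b∈H → resp (sym (⁻¹-^ x b)) (⁻¹∈ x^b∈H)
      }

    conj-identity : conj G ε H ≐ H
    conj-identity = resp (^-identityʳ _) , resp (sym (^-identityʳ _))

    conj-∙ : ∀ b b' → conj G b (conj G b' H) ≐ conj G (b ∙ b') H
    conj-∙ b b' = resp (^-∙-assoc _ b b') , resp (sym (^-∙-assoc _ b b'))

  module _ {p : Level} {B : Pred Carrier p} (B-sub : IsSubgroup G B) where
    private module B = IsSubgroup B-sub

    Arrow-refl : ∀ {k} → IsSubgroup G k → Arrow G B k k
    Arrow-refl k-sub = (λ x∈k∩B → x∈k∩B)
                     , λ {g} g∈k → g , ε , g∈k , (IsSubgroup.ε∈ k-sub , B.ε∈) , sym (identityʳ g)

    Arrow-respʳ : ∀ {k k' k''} → Arrow G B k k' → k' ≐ k'' → Arrow G B k k''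
    Arrow-respʳ (k∩B⊆k' , k'⊆k·k'B) (k'⊆k'' , k''⊆k') =
        (λ x∈k∩B → let (x∈k' , x∈B) = k∩B⊆k' x∈k∩B in k'⊆k'' x∈k' , x∈B)
      , λ g∈k'' → let (x , y , x∈k , (y∈k' , y∈B) , g≈xy) = k'⊆k·k'B (k''⊆k' g∈k'')
                  in x , y , x∈k , (k'⊆k'' y∈k' , y∈B) , g≈xy

    -- A factorisation g = y z  (y ∈ k', z ∈ k''_B) is refined by y = x w  (x ∈ k, w ∈ k'_B ⊆ k''_B).
    Arrow-trans : ∀ {k k' k''} → IsSubgroup G k'' →
                  Arrow G B k k' → Arrow G B k' k'' → Arrow G B k k''
    Arrow-trans k''-sub (k∩B⊆k' , k'⊆k·k'B) (k'∩B⊆k'' , k''⊆k'·k''B) =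
        (λ x∈k∩B → k'∩B⊆k'' (k∩B⊆k' x∈k∩B))
      , λ {g} g∈k'' →
          let (y , z , y∈k' , (z∈k'' , z∈B) , g≈yz) = k''⊆k'·k''B g∈k''
              (x , w , x∈k , w∈k'∩B , y≈xw)         = k'⊆k·k'B y∈k'
              (w∈k'' , w∈B)                          = k'∩B⊆k'' w∈k'∩B
          in x , w ∙ z , x∈k , (IsSubgroup.∙∈ k''-sub w∈k'' z∈k'' , B.∙∈ w∈B z∈B)
           , (begin
               g           ≈⟨ g≈yz ⟩
               y ∙ z       ≈⟨ ∙-congʳ y≈xw ⟩
               (x ∙ w) ∙ z ≈⟨ assoc x w z ⟩
               x ∙ (w ∙ z) ∎)

    Arrow-conj : ∀ {k k' b} → IsSubgroup G k → IsSubgroup G k' → b ∈ B →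
                 Arrow G B k k' → Arrow G B (conj G b k) (conj G b k')
    Arrow-conj {b = b} k-sub k'-sub b∈B (k∩B⊆k' , k'⊆k·k'B) =
        (λ (x^b∈k , x∈B) → proj₁ (k∩B⊆k' (x^b∈k , ^-closed B-sub x∈B b∈B)) , x∈B)
      , λ {g} g^b∈k' →
          let (y , z , y∈k , (z∈k' , z∈B) , g^b≈yz) = k'⊆k·k'B g^b∈k'
          in y ^ b ⁻¹ , z ^ b ⁻¹
           , IsSubgroup.resp k-sub (sym (^-^-inverse y (inverseˡ b))) y∈k
           , ( IsSubgroup.resp k'-sub (sym (^-^-inverse z (inverseˡ b))) z∈k'
             , ^-closed B-sub z∈B (B.⁻¹∈ b∈B))
           , (begin
               g                     ≈⟨ ^-^-inverse g (inverseʳ b) ⟨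
               g ^ b ^ b ⁻¹          ≈⟨ ^-congˡ (b ⁻¹) g^b≈yz ⟩
               (y ∙ z) ^ b ⁻¹        ≈⟨ ^-distribʳ-∙ y z (b ⁻¹) ⟩
               y ^ b ⁻¹ ∙ z ^ b ⁻¹   ∎)

lemma3p3 : ∀ {c ℓ p q : Level} (G : Group c ℓ)
    (B : Pred (Group.Carrier G) p) → IsSubgroup G B →
    (IsOpenCompact : Pred (Pred (Group.Carrier G) p) q) →
    (k : Pred (Group.Carrier G) p) → IsSubgroup G k → IsOpenCompact k →
    𝔅 G B k (Group.ε G)
    × (∀ b b' → 𝔅 G B k b → 𝔅 G B k b' → 𝔅 G B k (Group._∙_ G b b'))
lemma3p3 G B B-sub _ k k-sub _ = ε∈𝔅 , ∙∈𝔅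
  where
  open Group G using (_∙_)
  open IsSubgroup B-sub using (ε∈; ∙∈)

  ε∈𝔅 : 𝔅 G B k (Group.ε G)
  ε∈𝔅 = ε∈ , Arrow-respʳ G B-sub (Arrow-refl G B-sub k-sub) (≐-sym (conj-identity G k-sub))

  ∙∈𝔅 : ∀ b b' → 𝔅 G B k b → 𝔅 G B k b' → 𝔅 G B k (b ∙ b')
  ∙∈𝔅 b b' (b∈B , k→bk) (b'∈B , k→b'k) =
    ∙∈ b∈B b'∈B
    , Arrow-trans G B-sub (conj-isSubgroup G k-sub (b ∙ b')) k→bk
        (Arrow-respʳ G B-sub
          (Arrow-conj G B-sub k-sub (conj-isSubgroup G k-sub b') b∈B k→b'k)
          (conj-∙ G k-sub b b'))
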